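{- Let $P$ be a finite poset. If $\operatorname{cw}(P)=|P|$, then $\operatorname{ch}(P)=\max\{|D_P[x]|:x\in P\}$.
   Context: $D_P[x]=\{u\in P:u\le x\}$. An inclusion representation of $P$ is a family $(S_x:x\in P)$ of sets with $x\le y$ iff $S_x\subseteq S_y$; its ground set is $\bigcup_xS_x$. The cube height $\operatorname{ch}(P)$ is the least $h$ such that $P$ has an inclusion representation with $|S_x|\le h$ for all $x$; the cube width $\operatorname{cw}(P)$ is the least $w$ such that $P$ has an inclusion representation with ground set of size $w$ and $|S_x|\le\operatorname{ch}(P)$ for all $x$. -}

module Defs where

open import Level using (0ℓ)
open import Data.Nat using (ℕ; _≤_; _⊔_)
open import Data.Fin using (Fin)
open import Data.Fin.Subset using (Subset; _⊆_; ∣_∣; ⋃; inside; outside)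
open import Data.Vec using (tabulate; foldr′)
open import Data.List using (List)
import Data.List as List
open import Data.Product using (Σ; _×_; ∃)
open import Function.Bundles using (_⇔_)
open import Relation.Binary.Core using (Rel)
open import Relation.Binary.Structures using (IsDecPartialOrder)
open import Relation.Binary.PropositionalEquality using (_≡_)
open import Relation.Nullary.Decidable using (does)
open import Data.Bool using (if_then_else_)

record FinPoset : Set₁ where
  field
    n     : ℕ
    _≤P_  : Rel (Fin n) 0ℓ
    isDPO : IsDecPartialOrder _≡_ _≤P_
  open IsDecPartialOrder isDPO public

module _ (P : FinPoset) where
  open FinPoset P

  card : ℕ
  card = n

  downSet : Fin n → Subset n
  downSet x = tabulate (λ u → if does (u ≤? x) then inside else outside)

  -- max { |D_P[x]| : x ∈ P }  (0 for the empty poset)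
  maxDown : ℕ
  maxDown = foldr′ _⊔_ 0 (tabulate (λ x → ∣ downSet x ∣))

  IsInclRep : {m : ℕ} → (Fin n → Subset m) → Set
  IsInclRep S = ∀ x y → (x ≤P y) ⇔ (S x ⊆ S y)

  groundSet : {m : ℕ} → (Fin n → Subset m) → Subset m
  groundSet S = ⋃ (List.tabulate S)

  HasRepHeight : ℕ → Set
  HasRepHeight h = Σ ℕ λ m → Σ (Fin n → Subset m) λ S →
    IsInclRep S × (∀ x → ∣ S x ∣ ≤ h)

  IsCubeHeight : ℕ → Set
  IsCubeHeight h = HasRepHeight h × (∀ h′ → HasRepHeight h′ → h ≤ h′)

  HasRepWidth : ℕ → ℕ → Set
  HasRepWidth h w = Σ ℕ λ m → Σ (Fin n → Subset m) λ S →
    IsInclRep S × (∀ x → ∣ S x ∣ ≤ h) × ∣ groundSet S ∣ ≡ w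

  IsCubeWidth : ℕ → Set
  IsCubeWidth w = Σ ℕ λ h → IsCubeHeight h × HasRepWidth h w ×
    (∀ w′ → HasRepWidth h w′ → w ≤ w′)

-- Representing P by its down-sets shows ch(P) ≤ max |D[x]|.  Conversely, let S be a
-- representation of height h and suppose h < |D[x]|, so that B = D[x], A = S_x satisfy
-- S_z ⊆ A for all z ∈ B and |A| < |B|.  As long as some y has |D[y] ∖ B| > |S_y ∖ A|,
-- replacing B by B ∪ D[y] and A by A ∪ S_y preserves both properties.  Once no such y
-- is left, T_y = (S_y ∩ A) ⊎ (D[y] ∖ B) is again a representation of height ≤ h
-- (elements of B are told apart by A, the others by themselves), and its ground set
-- lies in A ⊎ (P ∖ B), which has fewer than |P| elements; so cw(P) < |P|.

module Submission where

import Data.List as List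
open import Data.Bool using (if_then_else_)
open import Data.Fin using (Fin; zero; suc)
open import Data.Fin.Properties using (any?)
open import Data.Fin.Subset
open import Data.Fin.Subset.Induction using (⊃-wellFounded)
open import Data.Fin.Subset.Properties
  using (drop-∷-⊆; ⊆-refl; ⊥⊆; ∣p∣≤n; p⊆q⇒∣p∣≤∣q∣; ∣∁p∣≡n∸∣p∣; x∉p⇒x∈∁p; _∈?_;
         x∈p∩q⁺; x∈p∩q⁻; p∩q⊆q; p⊆p∪q; q⊆p∪q; x∈p∪q⁺; x∈p∪q⁻; x∈p∧x∉q⇒x∈p─q; p─q⊆p)
open import Data.List.Relation.Unary.All using (All; []; _∷_)
open import Data.List.Relation.Unary.All.Properties using (tabulate⁺)
open import Data.Nat using (ℕ; suc; _+_; _∸_; _≤_; _<_; _⊔_; z≤n; _<?_)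
open import Data.Nat.Properties
  using (+-suc; m≤m⊔n; m≤n⊔m; ⊔-sel; ≤-trans; +-monoʳ-≤; +-mono-<; +-monoˡ-<; m+[n∸m]≡n;
         ≤-<-trans; ≮⇒≥; <⇒≱; module ≤-Reasoning)
open import Data.Product using (_×_; _,_; ∃; ∃₂; proj₁; proj₂)
open import Data.Sum using (inj₁; inj₂)
open import Data.Vec using (_∷_; []; _++_; tabulate; foldr′; here; there)
open import Data.Vec.Properties using (lookup∘tabulate; lookup⇒[]=; []=⇒lookup)
open import Function using (_∘_)
open import Function.Bundles using (Equivalence; mk⇔)
open import Induction.WellFounded using (Acc; acc)
open import Relation.Binary.PropositionalEquality using (_≡_; refl; sym; trans; cong; subst; subst₂)
open import Relation.Nullary using (yes; no; contradiction)
open import Relation.Nullary.Decidable using (dec-true)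

open import Defs

private
  variable
    k l : ℕ
    x : Fin k
    p p′ q r : Subset k

x∈p─q⇒x∉q : x ∈ p ─ q → x ∉ q
x∈p─q⇒x∉q {p = inside ∷ p} {q = outside ∷ q} here = λ ()
x∈p─q⇒x∉q {p = _ ∷ p} {q = _ ∷ q} (there x∈p─q) (there x∈q) = x∈p─q⇒x∉q x∈p─q x∈q

p─q⊆∁q : p ─ q ⊆ ∁ q
p─q⊆∁q = x∉p⇒x∈∁p ∘ x∈p─q⇒x∉q

0<∣p∣⇒Nonempty : 0 < ∣ p ∣ → Nonempty p
0<∣p∣⇒Nonempty {p = inside ∷ p}  _   = zero , here
0<∣p∣⇒Nonempty {p = outside ∷ p} pos = let x , x∈p = 0<∣p∣⇒Nonempty pos in suc x , there x∈p

p⊂p∪q : Nonempty (q ─ p) → p ⊂ p ∪ q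
p⊂p∪q {q = q} {p = p} (x , x∈q─p) =
  p⊆p∪q q , x , x∈p∪q⁺ (inj₂ (p─q⊆p q p x∈q─p)) , x∈p─q⇒x∉q x∈q─p

∣p∩q∣+∣p─q∣≡∣p∣ : ∀ (p q : Subset k) → ∣ p ∩ q ∣ + ∣ p ─ q ∣ ≡ ∣ p ∣
∣p∩q∣+∣p─q∣≡∣p∣ []            []            = refl
∣p∩q∣+∣p─q∣≡∣p∣ (inside  ∷ p) (inside  ∷ q) = cong suc (∣p∩q∣+∣p─q∣≡∣p∣ p q)
∣p∩q∣+∣p─q∣≡∣p∣ (inside  ∷ p) (outside ∷ q) = trans (+-suc _ _) (cong suc (∣p∩q∣+∣p─q∣≡∣p∣ p q))
∣p∩q∣+∣p─q∣≡∣p∣ (outside ∷ p) (inside  ∷ q) = ∣p∩q∣+∣p─q∣≡∣p∣ p q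
∣p∩q∣+∣p─q∣≡∣p∣ (outside ∷ p) (outside ∷ q) = ∣p∩q∣+∣p─q∣≡∣p∣ p q

∣p∪q∣≡∣p∣+∣q─p∣ : ∀ (p q : Subset k) → ∣ p ∪ q ∣ ≡ ∣ p ∣ + ∣ q ─ p ∣
∣p∪q∣≡∣p∣+∣q─p∣ []            []            = refl
∣p∪q∣≡∣p∣+∣q─p∣ (inside  ∷ p) (_       ∷ q) = cong suc (∣p∪q∣≡∣p∣+∣q─p∣ p q)
∣p∪q∣≡∣p∣+∣q─p∣ (outside ∷ p) (inside  ∷ q) = trans (cong suc (∣p∪q∣≡∣p∣+∣q─p∣ p q)) (sym (+-suc _ _))
∣p∪q∣≡∣p∣+∣q─p∣ (outside ∷ p) (outside ∷ q) = ∣p∪q∣≡∣p∣+∣q─p∣ p q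

∣p++q∣≡∣p∣+∣q∣ : ∀ (p : Subset k) (q : Subset l) → ∣ p ++ q ∣ ≡ ∣ p ∣ + ∣ q ∣
∣p++q∣≡∣p∣+∣q∣ []            q = refl
∣p++q∣≡∣p∣+∣q∣ (inside  ∷ p) q = cong suc (∣p++q∣≡∣p∣+∣q∣ p q)
∣p++q∣≡∣p∣+∣q∣ (outside ∷ p) q = ∣p++q∣≡∣p∣+∣q∣ p q

⊆-++⁺ : {p p′ : Subset k} {q q′ : Subset l} → p ⊆ p′ → q ⊆ q′ → p ++ q ⊆ p′ ++ q′
⊆-++⁺ {p = []}    {[]}     _   q⊆q′ = q⊆q′
⊆-++⁺ {p = _ ∷ _} {_ ∷ _} p⊆p′ q⊆q′ here with p⊆p′ here
... | here = here
⊆-++⁺ {p = _ ∷ _} {_ ∷ _} p⊆p′ q⊆q′ (there x∈) = there (⊆-++⁺ (drop-∷-⊆ p⊆p′) q⊆q′ x∈)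

⊆-++⁻ : {p p′ : Subset k} {q q′ : Subset l} → p ++ q ⊆ p′ ++ q′ → p ⊆ p′ × q ⊆ q′
⊆-++⁻ {p = []}    {[]}    sub = ⊆-refl , sub
⊆-++⁻ {p = s ∷ p} {s′ ∷ p′} sub = s∷p⊆s′∷p′ , proj₂ (⊆-++⁻ (drop-∷-⊆ sub))
  where
  s∷p⊆s′∷p′ : s ∷ p ⊆ s′ ∷ p′
  s∷p⊆s′∷p′ here with sub here
  ... | here = here
  s∷p⊆s′∷p′ (there x∈p) = there (proj₁ (⊆-++⁻ (drop-∷-⊆ sub)) x∈p)

∩-monoˡ-⊆ : p ⊆ p′ → p ∩ q ⊆ p′ ∩ q
∩-monoˡ-⊆ p⊆p′ x∈ = let x∈p , x∈q = x∈p∩q⁻ _ _ x∈ in x∈p∩q⁺ (p⊆p′ x∈p , x∈q)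

─-monoˡ-⊆ : p ⊆ p′ → p ─ q ⊆ p′ ─ q
─-monoˡ-⊆ p⊆p′ x∈ = x∈p∧x∉q⇒x∈p─q (p⊆p′ (p─q⊆p _ _ x∈)) (x∈p─q⇒x∉q x∈)

⋃-least : {ps : List.List (Subset k)} → All (_⊆ r) ps → ⋃ ps ⊆ r
⋃-least []           x∈ = ⊥⊆ x∈
⋃-least (p⊆r ∷ ps⊆r) x∈ with x∈p∪q⁻ _ _ x∈
... | inj₁ x∈p  = p⊆r x∈p
... | inj₂ x∈ps = ⋃-least ps⊆r x∈ps

f≤foldr⊔ : (f : Fin k → ℕ) (x : Fin k) → f x ≤ foldr′ _⊔_ 0 (tabulate f)
f≤foldr⊔ f zero    = m≤m⊔n _ _
f≤foldr⊔ f (suc x) = ≤-trans (f≤foldr⊔ (f ∘ suc) x) (m≤n⊔m (f zero) _)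

<foldr⊔⇒<f : (f : Fin k → ℕ) {c : ℕ} → c < foldr′ _⊔_ 0 (tabulate f) → ∃ λ x → c < f x
<foldr⊔⇒<f {k = suc k} f {c} c<max with ⊔-sel (f zero) (foldr′ _⊔_ 0 (tabulate (f ∘ suc)))
... | inj₁ max≡f0 = zero , subst (c <_) max≡f0 c<max
... | inj₂ max≡rest = let x , c<fx = <foldr⊔⇒<f (f ∘ suc) (subst (c <_) max≡rest c<max) in suc x , c<fx

module _ (P : FinPoset) where
  open FinPoset P using (n; _≤P_) renaming (_≤?_ to _≤P?_; refl to ≤P-refl; trans to ≤P-trans)

  private
    D : Fin n → Subset n
    D = downSet P

  ∈-downSet⁺ : ∀ {u y} → u ≤P y → u ∈ D y
  ∈-downSet⁺ {u} {y} u≤y = lookup⇒[]= u (D y)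
    (trans (lookup∘tabulate _ u) (cong (if_then inside else outside) (dec-true (u ≤P? y) u≤y)))

  ∈-downSet⁻ : ∀ {u y} → u ∈ D y → u ≤P y
  ∈-downSet⁻ {u} {y} u∈ with u ≤P? y | trans (sym (lookup∘tabulate _ u)) ([]=⇒lookup u∈)
  ... | yes u≤y | _ = u≤y
  ... | no _    | ()

  downSet-mono : ∀ {x y} → x ≤P y → D x ⊆ D y
  downSet-mono x≤y u∈ = ∈-downSet⁺ (≤P-trans (∈-downSet⁻ u∈) x≤y)

  downSet-isInclRep : IsInclRep P D
  downSet-isInclRep x y = mk⇔ downSet-mono (λ Dx⊆Dy → ∈-downSet⁻ (Dx⊆Dy (∈-downSet⁺ ≤P-refl)))

  downSet-hasRepHeight : HasRepHeight P (maxDown P)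
  downSet-hasRepHeight = n , D , downSet-isInclRep , f≤foldr⊔ (λ x → ∣ D x ∣)

  module Compression {m : ℕ} {S : Fin n → Subset m} (S-rep : IsInclRep P S) where

    S-mono : ∀ {x y} → x ≤P y → S x ⊆ S y
    S-mono = Equivalence.to (S-rep _ _)

    S-reflects : ∀ {x y} → S x ⊆ S y → x ≤P y
    S-reflects = Equivalence.from (S-rep _ _)

    record Deficient (B : Subset n) (A : Subset m) : Set where
      field
        covers  : ∀ {z} → z ∈ B → S z ⊆ A
        smaller : ∣ A ∣ < ∣ B ∣

    Saturated : Subset n → Subset m → Set
    Saturated B A = ∀ y → ∣ D y ─ B ∣ ≤ ∣ S y ─ A ∣

    deficient-downSet : ∀ {x} → ∣ S x ∣ < ∣ D x ∣ → Deficient (D x) (S x)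
    deficient-downSet Sx<Dx = record { covers = S-mono ∘ ∈-downSet⁻ ; smaller = Sx<Dx }

    deficient-∪ : ∀ {B A y} → Deficient B A → ∣ S y ─ A ∣ < ∣ D y ─ B ∣ →
                  Deficient (B ∪ D y) (A ∪ S y)
    deficient-∪ {B} {A} {y} def gain = record { covers = covers′ ; smaller = smaller′ }
      where
      open Deficient def
      covers′ : ∀ {z} → z ∈ B ∪ D y → S z ⊆ A ∪ S y
      covers′ z∈ with x∈p∪q⁻ B (D y) z∈
      ... | inj₁ z∈B  = p⊆p∪q (S y) ∘ covers z∈B
      ... | inj₂ z∈Dy = q⊆p∪q A (S y) ∘ S-mono (∈-downSet⁻ z∈Dy)
      smaller′ : ∣ A ∪ S y ∣ < ∣ B ∪ D y ∣
      smaller′ = subst₂ _<_ (sym (∣p∪q∣≡∣p∣+∣q─p∣ A (S y))) (sym (∣p∪q∣≡∣p∣+∣q─p∣ B (D y)))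
                            (+-mono-< smaller gain)

    saturate : ∀ {B A} → Acc _⊃_ B → Deficient B A →
               ∃₂ λ B′ A′ → Deficient B′ A′ × Saturated B′ A′
    saturate {B} {A} (acc larger) def with any? (λ y → ∣ S y ─ A ∣ <? ∣ D y ─ B ∣)
    ... | yes (y , gain) = saturate (larger (p⊂p∪q (0<∣p∣⇒Nonempty (≤-<-trans z≤n gain))))
                                    (deficient-∪ def gain)
    ... | no no-gain     = B , A , def , λ y → ≮⇒≥ (no-gain ∘ (y ,_))

    module _ {B A} (def : Deficient B A) (sat : Saturated B A) where
      open Deficient def

      compress : Fin n → Subset (m + n)
      compress y = (S y ∩ A) ++ (D y ─ B)

      compress-mono : ∀ {x y} → x ≤P y → compress x ⊆ compress y
      compress-mono x≤y = ⊆-++⁺ (∩-monoˡ-⊆ (S-mono x≤y)) (─-monoˡ-⊆ (downSet-mono x≤y))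

      compress-reflects : ∀ {x y} → compress x ⊆ compress y → x ≤P y
      compress-reflects {x} {y} sub with x ∈? B
      ... | yes x∈B = S-reflects λ u∈Sx →
            proj₁ (x∈p∩q⁻ _ _ (proj₁ (⊆-++⁻ sub) (x∈p∩q⁺ (u∈Sx , covers x∈B u∈Sx))))
      ... | no x∉B  = ∈-downSet⁻ (p─q⊆p _ _ (proj₂ (⊆-++⁻ sub) (x∈p∧x∉q⇒x∈p─q (∈-downSet⁺ ≤P-refl) x∉B)))

      compress-isInclRep : IsInclRep P compress
      compress-isInclRep x y = mk⇔ compress-mono compress-reflects

      ∣compress∣≤∣S∣ : ∀ y → ∣ compress y ∣ ≤ ∣ S y ∣
      ∣compress∣≤∣S∣ y = begin
        ∣ (S y ∩ A) ++ (D y ─ B) ∣      ≡⟨ ∣p++q∣≡∣p∣+∣q∣ (S y ∩ A) (D y ─ B) ⟩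
        ∣ S y ∩ A ∣ + ∣ D y ─ B ∣       ≤⟨ +-monoʳ-≤ ∣ S y ∩ A ∣ (sat y) ⟩
        ∣ S y ∩ A ∣ + ∣ S y ─ A ∣       ≡⟨ ∣p∩q∣+∣p─q∣≡∣p∣ (S y) A ⟩
        ∣ S y ∣                         ∎
        where open ≤-Reasoning

      ∣groundSet-compress∣<n : ∣ groundSet P compress ∣ < n
      ∣groundSet-compress∣<n = begin-strict
        ∣ groundSet P compress ∣   ≤⟨ p⊆q⇒∣p∣≤∣q∣ ground⊆ ⟩
        ∣ A ++ ∁ B ∣               ≡⟨ ∣p++q∣≡∣p∣+∣q∣ A (∁ B) ⟩
        ∣ A ∣ + ∣ ∁ B ∣            <⟨ +-monoˡ-< ∣ ∁ B ∣ smaller ⟩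
        ∣ B ∣ + ∣ ∁ B ∣            ≡⟨ cong (∣ B ∣ +_) (∣∁p∣≡n∸∣p∣ B) ⟩
        ∣ B ∣ + (n ∸ ∣ B ∣)        ≡⟨ m+[n∸m]≡n (∣p∣≤n B) ⟩
        n                          ∎
        where
        open ≤-Reasoning
        ground⊆ : groundSet P compress ⊆ A ++ ∁ B
        ground⊆ = ⋃-least (tabulate⁺ λ y → ⊆-++⁺ (p∩q⊆q (S y) A) p─q⊆∁q)

  narrowerRep : ∀ {h} → HasRepHeight P h → h < maxDown P →
                ∃ λ w → HasRepWidth P h w × w < n
  narrowerRep (m , S , S-rep , ∣S∣≤h) h<max =
    let x , h<∣Dx∣ = <foldr⊔⇒<f (λ x → ∣ D x ∣) h<max
        B , A , def , sat = saturate (⊃-wellFounded _) (deficient-downSet (≤-<-trans (∣S∣≤h x) h<∣Dx∣))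
    in ∣ groundSet P (compress def sat) ∣
     , (m + n , compress def sat , compress-isInclRep def sat
       , (λ y → ≤-trans (∣compress∣≤∣S∣ def sat y) (∣S∣≤h y)) , refl)
     , ∣groundSet-compress∣<n def sat
    where open Compression S-rep

  maxDown≤height : ∀ {h} → HasRepHeight P h → (∀ w → HasRepWidth P h w → n ≤ w) → maxDown P ≤ h
  maxDown≤height {h} hasH minW with h <? maxDown P
  ... | no h≮max  = ≮⇒≥ h≮max
  ... | yes h<max = let w , hasW , w<n = narrowerRep hasH h<max in contradiction (minW w hasW) (<⇒≱ w<n)

lemma5p5 : (P : FinPoset) → IsCubeWidth P (card P) → IsCubeHeight P (maxDown P)
lemma5p5 P (h , (hasH , minH) , _ , minW) =
  downSet-hasRepHeight P , λ h′ hasH′ → ≤-trans (maxDown≤height P hasH minW) (minH h′ hasH′)
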